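{- Let $S=\{R_0,\ldots,R_d\}$ be a quasi-thin association scheme on a nonempty finite set $X$, $\mathbb{F}$ a field, $x\in X$, and $\mathcal{T}$ the Terwilliger $\mathbb{F}$-algebra of $S$ with respect to $x$. Fix a total order $\preceq$ on $X$. Let $\mathcal{R}=\{(g,h): k_g=k_h=|R_{g'}R_h|=2\}$, let $\mathcal{S}$ be the set of bad pairs of $S$, and $\mathcal{U}=\mathcal{R}\cup\mathcal{S}$. For $(i,j)\in\mathcal{U}$ (so $k_i=k_j=2$) write $xR_i=\{u_1,u_2\}$, $xR_j=\{v_1,v_2\}$ with $u_1\prec u_2$, $v_1\prec v_2$, and set $B_{ij}=E_{u_1v_1}+E_{u_2v_2}$. Then $$\mathcal{B}=\{B_{ij}:(i,j)\in\mathcal{U}\}\cup\{E_y^*JE_z^*: y,z\in\{0,\ldots,d\}\}$$ is an $\mathbb{F}$-basis of $\mathcal{T}$.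
   Context: An association scheme on $X$ is a partition $S=\{R_0,\ldots,R_d\}$ of $X\times X$ into nonempty relations with $R_0$ the diagonal, closed under transposes ($R_{c'}$ the transpose of $R_c$), with $p_{ij}^k=|\{\ell:(m,\ell)\in R_i,(\ell,n)\in R_j\}|$ independent of $(m,n)\in R_k$. Valency $k_a=|xR_a|$, $xR_a=\{z:(x,z)\in R_a\}$; $R_aR_b=\{R_c:p_{ab}^c>0\}$; quasi-thin: all $k_a\le2$. $A_b$ is the $(0,1)$ adjacency matrix of $R_b$ in $M_X(\mathbb{F})$, $E_z^*$ the diagonal $(0,1)$-matrix with $(i,i)$-entry $1$ iff $i\in xR_z$, $\mathcal{T}$ the subalgebra generated by all $A_b,E_z^*$, $J$ the all-one matrix, and $E_{uv}$ the matrix unit with single nonzero entry $1$ at $(u,v)$. A pair $(u,v)$ is a bad pair if there exist an integer $a\ge1$ and indices $i_b,j_b,\ell_b$ ($b=0,\ldots,a$) with $i_0=u$, $\ell_a=v$, $k_{i_b}=k_{\ell_b}=2$, $p_{i_bj_b}^{\ell_b}=1$ for all $b$, $\ell_c=i_{c+1}$ for $c=0,\ldots,a-1$, and $|R_{i_0'}R_{\ell_a}|=1$. -}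

module Defs where

open import Level using (Level; _⊔_)
open import Data.Nat as ℕ using (ℕ; zero; suc; _≤_; _<_)
open import Data.Fin as Fin using (Fin)
open import Data.Fin.Properties using () renaming (_≟_ to _≟ᶠ_)
open import Data.List using (List; length; filter; allFin)
open import Data.Product using (Σ; ∃; ∃-syntax; _×_; _,_)
open import Data.Sum using (_⊎_)
open import Data.Bool using (Bool; true; false; if_then_else_; _∧_)
open import Relation.Nullary using (¬_; Dec; does)
open import Relation.Nullary.Decidable using (_×-dec_)
open import Relation.Unary using (Decidable)
open import Relation.Binary.PropositionalEquality using (_≡_)
open import Relation.Binary using (Rel; IsStrictTotalOrder)
open import Algebra.Bundles using (CommutativeRing)

count : ∀ {n p} {P : Fin n → Set p} → Decidable P → ℕ
count {n} P? = length (filter P? (allFin n))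

record Field (c ℓ : Level) : Set (Level.suc (c ⊔ ℓ)) where
  field
    commutativeRing : CommutativeRing c ℓ
  open CommutativeRing commutativeRing public
  field
    0≉1     : ¬ (0# ≈ 1#)
    inverse : ∀ a → ¬ (a ≈ 0#) → ∃[ b ] (a * b ≈ 1#)

-- Association schemes on X = Fin n with relations R_0,…,R_d,
-- encoded by the function rel : X → X → Fin (suc d), rel u v = i iff
-- (u,v) ∈ R_i.

record AssociationScheme (n d : ℕ) : Set where
  field
    rel      : Fin n → Fin n → Fin (suc d)
    nonempty : ∀ i → ∃[ u ] ∃[ v ] (rel u v ≡ i)
    diag→    : ∀ u v → rel u v ≡ Fin.zero → u ≡ v
    →diag    : ∀ u v → u ≡ v → rel u v ≡ Fin.zero
    _′       : Fin (suc d) → Fin (suc d)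
    transpose : ∀ u v → rel v u ≡ (rel u v) ′
    p        : Fin (suc d) → Fin (suc d) → Fin (suc d) → ℕ
    p-regular : ∀ i j k u v → rel u v ≡ k →
                count (λ ℓ → (rel u ℓ ≟ᶠ i) ×-dec (rel ℓ v ≟ᶠ j)) ≡ p i j k

  prodSize : Fin (suc d) → Fin (suc d) → ℕ
  prodSize a b = count (λ c → 0 ℕ.<? p a b c)

module _ {n d : ℕ} (S : AssociationScheme n d) (x : Fin n) where
  open AssociationScheme S

  valency : Fin (suc d) → ℕ
  valency a = count (λ z → rel x z ≟ᶠ a)

  QuasiThin : Set
  QuasiThin = ∀ a → valency a ≤ 2

  InR : Fin (suc d) → Fin (suc d) → Set
  InR g h = valency g ≡ 2 × valency h ≡ 2 × prodSize (g ′) h ≡ 2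

  BadPair : Fin (suc d) → Fin (suc d) → Set
  BadPair u v =
    Σ ℕ λ a → 1 ≤ a ×
    Σ (Fin (suc a) → Fin (suc d)) λ i →
    Σ (Fin (suc a) → Fin (suc d)) λ j →
    Σ (Fin (suc a) → Fin (suc d)) λ ℓ →
      i Fin.zero ≡ u × ℓ (Fin.fromℕ a) ≡ v
      × (∀ b → valency (i b) ≡ 2 × valency (ℓ b) ≡ 2 × p (i b) (j b) (ℓ b) ≡ 1)
      × (∀ (c : Fin a) → ℓ (Fin.inject₁ c) ≡ i (Fin.suc c))
      × prodSize (u ′) v ≡ 1

  InU : Fin (suc d) → Fin (suc d) → Set
  InU g h = InR g h ⊎ BadPair g h

module Matrices {c ℓ} (F : Field c ℓ) (n : ℕ) where
  open Field F

  Mat : Set c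
  Mat = Fin n → Fin n → Carrier

  _≈ᴹ_ : Mat → Mat → Set ℓ
  M ≈ᴹ N = ∀ u v → M u v ≈ N u v

  Σᶠ : ∀ {m} → (Fin m → Carrier) → Carrier
  Σᶠ {zero}  f = 0#
  Σᶠ {suc m} f = f Fin.zero + Σᶠ (λ i → f (Fin.suc i))

  _+ᴹ_ : Mat → Mat → Mat
  (M +ᴹ N) u v = M u v + N u v

  _*ᴹ_ : Mat → Mat → Mat
  (M *ᴹ N) u v = Σᶠ (λ w → M u w * N w v)

  _·ᴹ_ : Carrier → Mat → Mat
  (a ·ᴹ M) u v = a * M u v

  0ᴹ 1ᴹ Jᴹ : Mat
  0ᴹ u v = 0#
  1ᴹ u v = if does (u ≟ᶠ v) then 1# else 0#
  Jᴹ u v = 1#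

  Σᴹ : ∀ {m} → (Fin m → Mat) → Mat
  Σᴹ f u v = Σᶠ (λ i → f i u v)

  data Generated {i} {I : Set i} (G : I → Mat) : Mat → Set (c ⊔ ℓ ⊔ i) where
    gen  : ∀ k → Generated G (G k)
    one  : Generated G 1ᴹ
    zer  : Generated G 0ᴹ
    add  : ∀ {M N} → Generated G M → Generated G N → Generated G (M +ᴹ N)
    mul  : ∀ {M N} → Generated G M → Generated G N → Generated G (M *ᴹ N)
    scal : ∀ a {M} → Generated G M → Generated G (a ·ᴹ M)
    resp : ∀ {M N} → M ≈ᴹ N → Generated G M → Generated G N

module Terwilliger {c ℓ} (F : Field c ℓ) {n d : ℕ}
                   (S : AssociationScheme n d) (x : Fin n) where
  open Field F
  open AssociationScheme S
  open Matrices F n public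

  A : Fin (suc d) → Mat
  A b u v = if does (rel u v ≟ᶠ b) then 1# else 0#

  E* : Fin (suc d) → Mat
  E* z u v = if does (u ≟ᶠ v) ∧ does (rel x u ≟ᶠ z) then 1# else 0#

  data TGen : Set where
    adj  : Fin (suc d) → TGen
    dual : Fin (suc d) → TGen

  gens : TGen → Mat
  gens (adj b)  = A b
  gens (dual z) = E* z

  InT : Mat → Set (c ⊔ ℓ)
  InT = Generated gens

  module _ {ℓ<} {_≺_ : Rel (Fin n) ℓ<}
           (sto : IsStrictTotalOrder _≡_ _≺_) where
    open IsStrictTotalOrder sto using () renaming (_<?_ to _≺?_)

    -- position of w among the elements of x R_i, listed in ≺-increasing order
    rank : Fin (suc d) → Fin n → ℕ
    rank i w = count (λ y → (rel x y ≟ᶠ i) ×-dec (y ≺? w))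

    -- B_ij u v = 1 iff u ∈ xR_i, v ∈ xR_j, and u, v occupy the same position;
    -- for k_i = k_j = 2 this is E_{u₁v₁} + E_{u₂v₂}.
    B : Fin (suc d) → Fin (suc d) → Mat
    B i j u v = if does (rel x u ≟ᶠ i) ∧ does (rel x v ≟ᶠ j)
                   ∧ does (rank i u ℕ.≟ rank j v)
                then 1# else 0#

  EJE : Fin (suc d) → Fin (suc d) → Mat
  EJE y z = (E* y *ᴹ Jᴹ) *ᴹ E* z

  combo : (Fin (suc d) → Fin (suc d) → Mat) →
          (Fin (suc d) → Fin (suc d) → Carrier) →
          (Fin (suc d) → Fin (suc d) → Carrier) → Mat
  combo Bm cf ef =
    Σᴹ (λ i → Σᴹ (λ j → cf i j ·ᴹ Bm i j))
    +ᴹ Σᴹ (λ y → Σᴹ (λ z → ef y z ·ᴹ EJE y z))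

  -- Coefficient functions on pairs (i,j) are required to vanish off 𝓤.
  IsBasis : (Fin (suc d) → Fin (suc d) → Mat) → Set (c ⊔ ℓ)
  IsBasis Bm =
    (∀ i j → InU S x i j → InT (Bm i j))
    × (∀ y z → InT (EJE y z))
    × (∀ cf ef → (∀ i j → ¬ InU S x i j → cf i j ≈ 0#) →
         combo Bm cf ef ≈ᴹ 0ᴹ →
         (∀ i j → cf i j ≈ 0#) × (∀ y z → ef y z ≈ 0#))
    × (∀ M → InT M →
         ∃[ cf ] ∃[ ef ] ((∀ i j → ¬ InU S x i j → cf i j ≈ 0#)
                          × M ≈ᴹ combo Bm cf ef))

module Submission where

-- In a quasi-thin scheme each x R_y has at most two elements, and sending u to the other
-- element of its cell (or to itself) is an involution mate with rel (mate u) (mate v) =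
-- rel u v, by regularity of the intersection numbers.  Every M ∈ 𝒯 then satisfies two
-- linear constraints: M is invariant under mate × mate, and M u (mate v) = M u v whenever
-- (cell u, cell v) ∉ 𝓤.  For A_b the latter holds since outside 𝓡 the rows of a block are
-- constant; it survives products because 𝓤 is exactly reachability in the graph 𝓡 (a bad
-- pair is a chain of 𝓡-edges whose ends have |R_{y'} R_z| = 1), hence transitive.  So M is
-- determined by its entries at (u₁, v₁) and (u₁, v₂) of each block, which writes M in ℬ
-- with coefficients vanishing off 𝓤, and evaluating at those entries shows ℬ independent.
-- Conversely ℬ ⊆ 𝒯: J = Σ_b A_b, B_yz = E*_y A_a E*_z for (y, z) ∈ 𝓡 and a = rel u₁ v₁,
-- and B_yz = B_yw B_wz along the edges of 𝓡.

open import Data.Nat as ℕ using (ℕ; zero; suc; _≤_; _<_; z≤n; s≤s)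
import Data.Nat.Properties as ℕₚ
open import Algebra.Properties.CommutativeSemigroup ℕₚ.+-commutativeSemigroup using (x∙yz≈y∙xz)
open import Data.Fin as Fin using (Fin; toℕ; fromℕ<)
open import Data.Fin.Properties using (any?; toℕ-fromℕ<; toℕ<n; toℕ-injective; suc-injective)
  renaming (_≟_ to _≟ᶠ_)
open import Data.Fin.Permutation using (permutation)
open import Data.Bool using (Bool; true; false; _∧_; not; if_then_else_)
open import Data.Bool.Properties using (∧-comm; ∧-zeroʳ; ∧-identityʳ)
open import Data.List using (length; filter; tabulate)
open import Data.Product using (Σ-syntax; ∃-syntax; _×_; _,_; proj₁; proj₂; map₂)
open import Data.Sum using (_⊎_; inj₁; inj₂; [_,_]; map)
open import Data.Empty using (⊥; ⊥-elim)
open import Data.Unit using (⊤; tt)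
open import Function using (_∘_; id)
open import Function.Bundles using (mk⇔)
open import Relation.Nullary using (¬_; Dec; does; yes; no; ¬?)
open import Relation.Nullary.Decidable using (dec-true; dec-false; does-⇔; map′; _⊎-dec_; _×-dec_)
open import Relation.Unary using (Decidable)
open import Relation.Binary using (Rel; IsStrictTotalOrder; tri<; tri≈; tri>)
open import Relation.Binary.PropositionalEquality as ≡ using (_≡_; _≢_)
open import Defs

module Counting where
  open import Data.Nat using (_+_)
  open ≡ using (refl; sym; trans; cong; cong₂)

  toℕᵇ : Bool → ℕ
  toℕᵇ true  = 1
  toℕᵇ false = 0

  countᵇ : ∀ {m} → (Fin m → Bool) → ℕ
  countᵇ {zero}  f = 0
  countᵇ {suc m} f = toℕᵇ (f Fin.zero) + countᵇ (f ∘ Fin.suc)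

  length-filter-tabulate : ∀ {n p} {P : Fin n → Set p} (P? : Decidable P) {m} (g : Fin m → Fin n) →
    length (filter P? (tabulate g)) ≡ countᵇ (λ i → does (P? (g i)))
  length-filter-tabulate P? {zero}  g = refl
  length-filter-tabulate P? {suc m} g with does (P? (g Fin.zero))
  ... | true  = cong suc (length-filter-tabulate P? (g ∘ Fin.suc))
  ... | false = length-filter-tabulate P? (g ∘ Fin.suc)

  count≡countᵇ : ∀ {n p} {P : Fin n → Set p} (P? : Decidable P) → count P? ≡ countᵇ (does ∘ P?)
  count≡countᵇ P? = length-filter-tabulate P? id

  countᵇ-cong : ∀ {m} {f g : Fin m → Bool} → (∀ i → f i ≡ g i) → countᵇ f ≡ countᵇ g
  countᵇ-cong {zero}  e = refl
  countᵇ-cong {suc m} e = cong₂ _+_ (cong toℕᵇ (e Fin.zero)) (countᵇ-cong (e ∘ Fin.suc))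

  countᵇ-false : ∀ {m} {f : Fin m → Bool} → (∀ i → f i ≡ false) → countᵇ f ≡ 0
  countᵇ-false {zero}  e = refl
  countᵇ-false {suc m} e rewrite e Fin.zero = countᵇ-false (e ∘ Fin.suc)

  countᵇ≢0⇒∃true : ∀ {m} (f : Fin m → Bool) → countᵇ f ≢ 0 → ∃[ i ] f i ≡ true
  countᵇ≢0⇒∃true {zero}  f ne = ⊥-elim (ne refl)
  countᵇ≢0⇒∃true {suc m} f ne with f Fin.zero in eq
  ... | true  = Fin.zero , eq
  ... | false with countᵇ≢0⇒∃true (f ∘ Fin.suc) ne
  ...   | i , fi = Fin.suc i , fi

  1≡toℕᵇ⇒true : ∀ {b} → 1 ≡ toℕᵇ b → b ≡ true
  1≡toℕᵇ⇒true {true} _ = refl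

  remove : ∀ {m} → Fin m → (Fin m → Bool) → Fin m → Bool
  remove a f i = f i ∧ not (does (i ≟ᶠ a))

  remove-≢ : ∀ {m} {a i : Fin m} f → i ≢ a → remove a f i ≡ f i
  remove-≢ {a = a} {i} f i≢a rewrite dec-false (i ≟ᶠ a) i≢a = ∧-identityʳ (f i)

  countᵇ-remove : ∀ {m} (a : Fin m) (f : Fin m → Bool) → countᵇ f ≡ toℕᵇ (f a) + countᵇ (remove a f)
  countᵇ-remove {suc m} Fin.zero f rewrite ∧-zeroʳ (f Fin.zero) =
    cong (toℕᵇ (f Fin.zero) +_) (countᵇ-cong (λ i → sym (∧-identityʳ (f (Fin.suc i)))))
  countᵇ-remove {suc m} (Fin.suc a) f
    rewrite countᵇ-remove a (f ∘ Fin.suc) | ∧-identityʳ (f Fin.zero) =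
    x∙yz≈y∙xz (toℕᵇ (f Fin.zero)) (toℕᵇ (f (Fin.suc a))) _

  countᵇ-support₁ : ∀ {m} (f : Fin m → Bool) (a : Fin m) →
    (∀ i → f i ≡ true → i ≡ a) → countᵇ f ≡ toℕᵇ (f a)
  countᵇ-support₁ f a supp =
    trans (countᵇ-remove a f) (trans (cong (toℕᵇ (f a) +_) (countᵇ-false removed)) (ℕₚ.+-identityʳ _))
    where
    removed : ∀ i → remove a f i ≡ false
    removed i with i ≟ᶠ a
    ... | yes _ = ∧-zeroʳ (f i)
    ... | no i≢a with f i in fi
    ...   | true  = ⊥-elim (i≢a (supp i fi))
    ...   | false = refl

  countᵇ-support₂ : ∀ {m} (f : Fin m → Bool) (a b : Fin m) → a ≢ b →
    (∀ i → f i ≡ true → i ≡ a ⊎ i ≡ b) → countᵇ f ≡ toℕᵇ (f a) + toℕᵇ (f b)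
  countᵇ-support₂ f a b a≢b supp = trans (countᵇ-remove a f)
    (cong (toℕᵇ (f a) +_) (trans (countᵇ-support₁ (remove a f) b supp′)
                                  (cong toℕᵇ (remove-≢ f (a≢b ∘ sym)))))
    where
    supp′ : ∀ i → remove a f i ≡ true → i ≡ b
    supp′ i e with i ≟ᶠ a
    supp′ i e | yes _ with () ← trans (sym (∧-zeroʳ (f i))) e
    supp′ i e | no i≢a with supp i (trans (sym (∧-identityʳ (f i))) e)
    ... | inj₁ i≡a = ⊥-elim (i≢a i≡a)
    ... | inj₂ i≡b = i≡b

  1≤countᵇ : ∀ {m} (f : Fin m → Bool) (a : Fin m) → f a ≡ true → 1 ≤ countᵇ f
  1≤countᵇ f a fa rewrite countᵇ-remove a f | fa = s≤s z≤n

  3≤countᵇ : ∀ {m} (f : Fin m → Bool) (a b c : Fin m) → a ≢ b → a ≢ c → b ≢ c →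
    f a ≡ true → f b ≡ true → f c ≡ true → 3 ≤ countᵇ f
  3≤countᵇ f a b c a≢b a≢c b≢c fa fb fc
    rewrite countᵇ-remove a f | fa | countᵇ-remove b (remove a f) | remove-≢ f (a≢b ∘ sym) | fb
          | countᵇ-remove c (remove b (remove a f)) | remove-≢ (remove a f) (b≢c ∘ sym)
          | remove-≢ f (a≢c ∘ sym) | fc = s≤s (s≤s (s≤s z≤n))

  ≟-refl : ∀ {k} (a : Fin k) → does (a ≟ᶠ a) ≡ true
  ≟-refl a = dec-true (a ≟ᶠ a) refl

  does≡true⇒ : ∀ {a} {A : Set a} (a? : Dec A) → does a? ≡ true → A
  does≡true⇒ (yes a) _ = a

  count-positive⇒∃ : ∀ {n p} {P : Fin n → Set p} (P? : Decidable P) {k} → count P? ≡ k → 1 ≤ k → ∃[ t ] P t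
  count-positive⇒∃ P? {k} c≡k 1≤k
    with countᵇ≢0⇒∃true (does ∘ P?)
                        (λ c≡0 → ℕₚ.<⇒≢ 1≤k (trans (sym c≡0) (trans (sym (count≡countᵇ P?)) c≡k)))
  ... | t , Pt = t , does≡true⇒ (P? t) Pt

  1≤count : ∀ {n p} {P : Fin n → Set p} (P? : Decidable P) t → P t → 1 ≤ count P?
  1≤count P? t Pt = ≡.subst (1 ≤_) (sym (count≡countᵇ P?)) (1≤countᵇ (does ∘ P?) t (dec-true (P? t) Pt))

module Reachability {m : ℕ} (E : Fin m → Fin m → Set) (E? : ∀ u v → Dec (E u v)) where
  open ≡ using (refl; sym; trans; subst)

  data WalkVia (P : Fin m → Set) : Fin m → Fin m → Set where
    edge : ∀ {u v} → E u v → WalkVia P u v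
    step : ∀ {u w v} → E u w → P w → WalkVia P w v → WalkVia P u v

  Walk : Fin m → Fin m → Set
  Walk = WalkVia (λ _ → ⊤)

  weaken : ∀ {P Q : Fin m → Set} → (∀ {w} → P w → Q w) → ∀ {u v} → WalkVia P u v → WalkVia Q u v
  weaken f (edge e)       = edge e
  weaken f (step e p r)   = step e (f p) (weaken f r)

  join : ∀ {P : Fin m → Set} {u w v} → WalkVia P u w → P w → WalkVia P w v → WalkVia P u v
  join (edge e)     pw r = step e pw r
  join (step e p q) pw r = step e p (join q pw r)

  _++_ : ∀ {u w v} → Walk u w → Walk w v → Walk u v
  p ++ q = join p tt q

  _∖_ : (Fin m → Set) → Fin m → Fin m → Set
  (P ∖ a) w = P w × w ≢ a

  split-at : ∀ {P} (a : Fin m) {u v} → WalkVia P u v →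
             WalkVia (P ∖ a) u v ⊎ (WalkVia (P ∖ a) u a × WalkVia P a v)
  split-at a (edge e) = inj₁ (edge e)
  split-at a (step {w = w} e p r) with w ≟ᶠ a
  ... | yes refl = inj₂ (edge e , r)
  ... | no w≢a with split-at a r
  ...   | inj₁ q         = inj₁ (step e (p , w≢a) q)
  ...   | inj₂ (q₁ , q₂) = inj₂ (step e (p , w≢a) q₁ , q₂)

  last-visit : ∀ {P} (a : Fin m) {s v} → WalkVia P s v → WalkVia (P ∖ a) s v ⊎ WalkVia (P ∖ a) a v
  last-visit a (edge e) = inj₁ (edge e)
  last-visit a (step {w = w} e p r) with last-visit a r
  ... | inj₂ q = inj₂ q
  ... | inj₁ q with w ≟ᶠ a
  ...   | yes refl = inj₂ q
  ...   | no w≢a   = inj₁ (step e (p , w≢a) q)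

  shortcut : ∀ {P} (a : Fin m) {v} → WalkVia P a v → WalkVia (P ∖ a) a v
  shortcut a p with last-visit a p
  ... | inj₁ q = q
  ... | inj₂ q = q

  Below : ℕ → Fin m → Set
  Below k w = toℕ w < k

  below-∖-top : ∀ {k} (k<m : k < m) {w} → (Below (suc k) ∖ fromℕ< k<m) w → Below k w
  below-∖-top k<m (w<1+k , w≢k) with ℕₚ.m≤n⇒m<n∨m≡n (ℕ.s≤s⁻¹ w<1+k)
  ... | inj₁ w<k = w<k
  ... | inj₂ w≡k = ⊥-elim (w≢k (toℕ-injective (trans w≡k (sym (toℕ-fromℕ< k<m)))))

  below-suc : ∀ {k} (k<m : k < m) {u v} → WalkVia (Below (suc k)) u v →
              WalkVia (Below k) u v ⊎ (WalkVia (Below k) u (fromℕ< k<m) × WalkVia (Below k) (fromℕ< k<m) v)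
  below-suc {k} k<m p with split-at (fromℕ< k<m) p
  ... | inj₁ q         = inj₁ (weaken (below-∖-top k<m) q)
  ... | inj₂ (q₁ , q₂) =
        inj₂ (weaken (below-∖-top k<m) q₁ , weaken (below-∖-top k<m) (shortcut (fromℕ< k<m) q₂))

  -- Floyd–Warshall: bound the interior vertices of the walk by k.
  walkBelow? : ∀ k → k ≤ m → ∀ u v → Dec (WalkVia (Below k) u v)
  walkBelow? zero    _   u v with E? u v
  ... | yes e = yes (edge e)
  ... | no ¬e = no λ { (edge e) → ¬e e ; (step _ () _) }
  walkBelow? (suc k) k<m u v =
    map′ merge (below-suc k<m)
         (walkBelow? k k≤m u v ⊎-dec (walkBelow? k k≤m u κ ×-dec walkBelow? k k≤m κ v))
    where
    k≤m = ℕₚ.<⇒≤ k<m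
    κ = fromℕ< k<m
    merge : WalkVia (Below k) u v ⊎ (WalkVia (Below k) u κ × WalkVia (Below k) κ v) →
            WalkVia (Below (suc k)) u v
    merge (inj₁ q)         = weaken ℕₚ.m<n⇒m<1+n q
    merge (inj₂ (q₁ , q₂)) =
      join (weaken ℕₚ.m<n⇒m<1+n q₁) (subst (_< suc k) (sym (toℕ-fromℕ< k<m)) (ℕₚ.n<1+n k))
           (weaken ℕₚ.m<n⇒m<1+n q₂)

  walk? : ∀ u v → Dec (Walk u v)
  walk? u v = map′ (weaken _) (weaken (λ {w} _ → toℕ<n w)) (walkBelow? m ℕₚ.≤-refl u v)

module QuasiThinScheme {n d : ℕ} (S : AssociationScheme n d) (x : Fin n) (qt : QuasiThin S x) where
  open import Data.Nat using (_+_)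
  open ≡ using (refl; sym; trans; cong; cong₂; subst; subst₂)
  open AssociationScheme S
  open Counting

  cell : Fin n → Fin (suc d)
  cell = rel x

  ′-involutive : ∀ c → (c ′) ′ ≡ c
  ′-involutive c with nonempty c
  ... | u , v , refl = trans (cong _′ (sym (transpose u v))) (sym (transpose v u))

  ′-injective : ∀ {a b} → a ′ ≡ b ′ → a ≡ b
  ′-injective {a} {b} e = trans (sym (′-involutive a)) (trans (cong _′ e) (′-involutive b))

  rel-to-x : ∀ u → rel u x ≡ cell u ′
  rel-to-x = transpose x

  -- k_y = p_{y y'}^0 can be computed at any pair of R_0, and R_y is nonempty.
  opaque
    cell-surjective : ∀ y → ∃[ t ] cell t ≡ y
    cell-surjective y with nonempty y
    ... | u , v , uRv = map₂ proj₁ (count-positive⇒∃ (λ t → (rel x t ≟ᶠ y) ×-dec (rel t x ≟ᶠ y ′))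
          (p-regular y (y ′) Fin.zero x x (→diag x x refl))
          (subst (1 ≤_) (p-regular y (y ′) Fin.zero u u (→diag u u refl))
            (1≤count (λ t → (rel u t ≟ᶠ y) ×-dec (rel t u ≟ᶠ y ′)) v
                     (uRv , trans (transpose u v) (cong _′ uRv)))))

  valency≡countᵇ : ∀ y → valency S x y ≡ countᵇ (λ t → does (cell t ≟ᶠ y))
  valency≡countᵇ y = count≡countᵇ (λ t → cell t ≟ᶠ y)

  -- The other element of x R_{cell u}, or u itself when k_{cell u} = 1.
  mate : Fin n → Fin n
  mate u with any? (λ t → (cell t ≟ᶠ cell u) ×-dec ¬? (t ≟ᶠ u))
  ... | yes (t , _) = t
  ... | no _        = u

  mate-spec : ∀ u → (cell (mate u) ≡ cell u × mate u ≢ u)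
                  ⊎ (mate u ≡ u × (∀ t → cell t ≡ cell u → t ≡ u))
  mate-spec u with any? (λ t → (cell t ≟ᶠ cell u) ×-dec ¬? (t ≟ᶠ u))
  ... | yes (t , t-mate) = inj₁ t-mate
  ... | no ¬mate         = inj₂ (refl , alone)
    where
    alone : ∀ t → cell t ≡ cell u → t ≡ u
    alone t e with t ≟ᶠ u
    ... | yes t≡u = t≡u
    ... | no t≢u  = ⊥-elim (¬mate (t , e , t≢u))

  cell-mate : ∀ u → cell (mate u) ≡ cell u
  cell-mate u with mate-spec u
  ... | inj₁ (e , _) = e
  ... | inj₂ (e , _) = cong cell e

  same-cell : ∀ u t → cell t ≡ cell u → t ≡ u ⊎ t ≡ mate u
  same-cell u t e with mate-spec u
  ... | inj₂ (_ , alone) = inj₁ (alone t e)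
  ... | inj₁ (cell-mate-u , mate≢u) with t ≟ᶠ u | t ≟ᶠ mate u
  ...   | yes t≡u | _       = inj₁ t≡u
  ...   | no _    | yes t≡m = inj₂ t≡m
  ...   | no t≢u  | no t≢m  = ⊥-elim (ℕₚ.<⇒≱ (s≤s (s≤s (s≤s z≤n))) (ℕₚ.≤-trans three≤k k≤2))
    where
    k≤2 : countᵇ (λ s → does (cell s ≟ᶠ cell u)) ≤ 2
    k≤2 = subst (_≤ 2) (valency≡countᵇ (cell u)) (qt (cell u))
    three≤k : 3 ≤ countᵇ (λ s → does (cell s ≟ᶠ cell u))
    three≤k = 3≤countᵇ _ u (mate u) t (mate≢u ∘ sym) (t≢u ∘ sym) (t≢m ∘ sym)
                (≟-refl (cell u)) (dec-true (cell (mate u) ≟ᶠ cell u) cell-mate-u)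
                (dec-true (cell t ≟ᶠ cell u) e)

  mate-involutive : ∀ u → mate (mate u) ≡ u
  mate-involutive u with mate-spec u
  ... | inj₂ (e , _) = trans (cong mate e) e
  ... | inj₁ (cell-mate-u , mate≢u) with mate-spec (mate u)
  ...   | inj₂ (_ , alone) = ⊥-elim (mate≢u (sym (alone u (sym cell-mate-u))))
  ...   | inj₁ (cell-mate² , mate²≢mate) with same-cell u (mate (mate u)) (trans cell-mate² cell-mate-u)
  ...     | inj₁ e = e
  ...     | inj₂ e = ⊥-elim (mate²≢mate e)

  mate-injective : ∀ {u v} → mate u ≡ mate v → u ≡ v
  mate-injective {u} {v} e = trans (sym (mate-involutive u)) (trans (cong mate e) (mate-involutive v))

  countᵇ-cell-fixed : ∀ u (q : Fin n → Bool) → mate u ≡ u →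
    countᵇ (λ t → does (cell t ≟ᶠ cell u) ∧ q t) ≡ toℕᵇ (q u)
  countᵇ-cell-fixed u q fixed =
    trans (countᵇ-support₁ _ u supp) (cong (λ b → toℕᵇ (b ∧ q u)) (≟-refl (cell u)))
    where
    supp : ∀ t → does (cell t ≟ᶠ cell u) ∧ q t ≡ true → t ≡ u
    supp t r with cell t ≟ᶠ cell u
    supp t r | yes e with same-cell u t e
    ... | inj₁ t≡u = t≡u
    ... | inj₂ t≡m = trans t≡m fixed

  countᵇ-cell-moved : ∀ u (q : Fin n → Bool) → mate u ≢ u →
    countᵇ (λ t → does (cell t ≟ᶠ cell u) ∧ q t) ≡ toℕᵇ (q u) + toℕᵇ (q (mate u))
  countᵇ-cell-moved u q moved = trans (countᵇ-support₂ _ u (mate u) (moved ∘ sym) supp)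
    (cong₂ _+_ (cong (λ b → toℕᵇ (b ∧ q u)) (≟-refl (cell u)))
               (cong (λ b → toℕᵇ (b ∧ q (mate u))) (dec-true (cell (mate u) ≟ᶠ cell u) (cell-mate u))))
    where
    supp : ∀ t → does (cell t ≟ᶠ cell u) ∧ q t ≡ true → t ≡ u ⊎ t ≡ mate u
    supp t r with cell t ≟ᶠ cell u
    supp t r | yes e = same-cell u t e

  valency≡countᵇ-cell : ∀ u → valency S x (cell u) ≡ countᵇ (λ t → does (cell t ≟ᶠ cell u) ∧ true)
  valency≡countᵇ-cell u =
    trans (valency≡countᵇ (cell u)) (countᵇ-cong (λ t → sym (∧-identityʳ (does (cell t ≟ᶠ cell u)))))

  valency-moved : ∀ u → mate u ≢ u → valency S x (cell u) ≡ 2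
  valency-moved u moved = trans (valency≡countᵇ-cell u) (countᵇ-cell-moved u (λ _ → true) moved)

  valency≡2⇒moved : ∀ u → valency S x (cell u) ≡ 2 → mate u ≢ u
  valency≡2⇒moved u k≡2 fixed
    with () ← trans (sym k≡2) (trans (valency≡countᵇ-cell u) (countᵇ-cell-fixed u (λ _ → true) fixed))

  column row : Fin n → Fin n → Fin (suc d) → ℕ
  column u v j = countᵇ (λ m → does (cell m ≟ᶠ cell u) ∧ does (rel m v ≟ᶠ j))
  row    u v j = countᵇ (λ t → does (cell t ≟ᶠ cell v) ∧ does (rel u t ≟ᶠ j))

  column-count : ∀ u v j → column u v j ≡ p (cell u) j (cell v)
  column-count u v j = trans (sym (count≡countᵇ (λ m → (rel x m ≟ᶠ cell u) ×-dec (rel m v ≟ᶠ j))))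
                             (p-regular (cell u) j (cell v) x v refl)

  row-count : ∀ u v j → row u v j ≡ p j (cell v ′) (cell u ′)
  row-count u v j = trans (countᵇ-cong swap)
    (trans (sym (count≡countᵇ (λ t → (rel u t ≟ᶠ j) ×-dec (rel t x ≟ᶠ cell v ′))))
           (p-regular j (cell v ′) (cell u ′) u x (rel-to-x u)))
    where
    swap : ∀ t → does (cell t ≟ᶠ cell v) ∧ does (rel u t ≟ᶠ j)
               ≡ does (rel u t ≟ᶠ j) ∧ does (rel t x ≟ᶠ cell v ′)
    swap t = trans (∧-comm (does (cell t ≟ᶠ cell v)) (does (rel u t ≟ᶠ j)))
      (cong (does (rel u t ≟ᶠ j) ∧_)
        (does-⇔ (mk⇔ (λ e → trans (rel-to-x t) (cong _′ e)) (λ e → ′-injective (trans (sym (rel-to-x t)) e)))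
                (cell t ≟ᶠ cell v) (rel t x ≟ᶠ cell v ′)))

  column-count-cell : ∀ u v v′ j → cell v′ ≡ cell v → column u v j ≡ column u v′ j
  column-count-cell u v v′ j e =
    trans (column-count u v j) (trans (cong (p (cell u) j) (sym e)) (sym (column-count u v′ j)))

  row-count-cell : ∀ u u′ v j → cell u′ ≡ cell u → row u v j ≡ row u′ v j
  row-count-cell u u′ v j e =
    trans (row-count u v j) (trans (cong (λ c → p j (cell v ′) (c ′)) (sym e)) (sym (row-count u′ v j)))

  balanced-corner : ∀ b c e →
    1 + toℕᵇ b ≡ toℕᵇ c + toℕᵇ e → 1 + toℕᵇ c ≡ toℕᵇ b + toℕᵇ e → e ≡ true
  balanced-corner b     c     true  _  _  = refl
  balanced-corner true  true  false () _
  balanced-corner true  false false () _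
  balanced-corner false true  false _  ()
  balanced-corner false false false () _

  -- Rows and columns of the block {u, mate u} × {v, mate v} contain a = rel u v equally
  -- often (regularity), which forces the opposite corner to be a as well.
  rel-mate-mate : ∀ u v → rel (mate u) (mate v) ≡ rel u v
  rel-mate-mate u v with mate u ≟ᶠ u | mate v ≟ᶠ v
  ... | yes fu | yes fv rewrite fu | fv = refl
  ... | yes fu | no _ rewrite fu =
        does≡true⇒ (rel u (mate v) ≟ᶠ rel u v) (1≡toℕᵇ⇒true (
          trans (cong toℕᵇ (sym (≟-refl (rel u v))))
            (trans (sym (countᵇ-cell-fixed u _ fu))
              (trans (column-count-cell u v (mate v) (rel u v) (cell-mate v)) (countᵇ-cell-fixed u _ fu)))))
  ... | no _ | yes fv rewrite fv =
        does≡true⇒ (rel (mate u) v ≟ᶠ rel u v) (1≡toℕᵇ⇒true (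
          trans (cong toℕᵇ (sym (≟-refl (rel u v))))
            (trans (sym (countᵇ-cell-fixed v _ fv))
              (trans (row-count-cell u (mate u) v (rel u v) (cell-mate u)) (countᵇ-cell-fixed v _ fv)))))
  ... | no mu | no mv = does≡true⇒ (rel (mate u) (mate v) ≟ᶠ a) (balanced-corner B C E rows columns)
    where
    a = rel u v
    B = does (rel u (mate v) ≟ᶠ a)
    C = does (rel (mate u) v ≟ᶠ a)
    E = does (rel (mate u) (mate v) ≟ᶠ a)
    a≟a : 1 ≡ toℕᵇ (does (a ≟ᶠ a))
    a≟a = cong toℕᵇ (sym (≟-refl a))
    rows : 1 + toℕᵇ B ≡ toℕᵇ C + toℕᵇ E
    rows = trans (cong (_+ toℕᵇ B) a≟a)
      (trans (sym (countᵇ-cell-moved v (λ t → does (rel u t ≟ᶠ a)) mv))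
        (trans (row-count-cell u (mate u) v a (cell-mate u))
               (countᵇ-cell-moved v (λ t → does (rel (mate u) t ≟ᶠ a)) mv)))
    columns : 1 + toℕᵇ C ≡ toℕᵇ B + toℕᵇ E
    columns = trans (cong (_+ toℕᵇ C) a≟a)
      (trans (sym (countᵇ-cell-moved u (λ m → does (rel m v ≟ᶠ a)) mu))
        (trans (column-count-cell u v (mate v) a (cell-mate v))
               (countᵇ-cell-moved u (λ m → does (rel m (mate v) ≟ᶠ a)) mu)))

  rel-mate-swap : ∀ u v → rel (mate u) v ≡ rel u (mate v)
  rel-mate-swap u v = trans (cong (rel (mate u)) (sym (mate-involutive v))) (rel-mate-mate u (mate v))

  p-positive : ∀ u v → 0 < p (cell u ′) (cell v) (rel u v)
  p-positive u v = subst (1 ≤_) (p-regular (cell u ′) (cell v) (rel u v) u v refl)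
    (1≤count (λ t → (rel u t ≟ᶠ cell u ′) ×-dec (rel t v ≟ᶠ cell v)) x (rel-to-x u , refl))

  -- Move a witness of p_{y'z}^c > 0 to the base pair (u, x) ∈ R_{y'} via p_{c z'}^{y'} > 0.
  p-positive⇒∃ : ∀ u v c → 0 < p (cell u ′) (cell v) c → ∃[ s ] (cell s ≡ cell v × rel u s ≡ c)
  p-positive⇒∃ u v c pos with nonempty c
  ... | m , m′ , mRm′ with count-positive⇒∃ (λ t → (rel m t ≟ᶠ cell u ′) ×-dec (rel t m′ ≟ᶠ cell v))
                                              (p-regular (cell u ′) (cell v) c m m′ mRm′) pos
  ...   | t , mRt , tRm′ with count-positive⇒∃ (λ s → (rel u s ≟ᶠ c) ×-dec (rel s x ≟ᶠ cell v ′))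
                                                 (p-regular c (cell v ′) (cell u ′) u x (rel-to-x u)) pos′
    where
    pos′ : 1 ≤ p c (cell v ′) (cell u ′)
    pos′ = subst (1 ≤_) (p-regular c (cell v ′) (cell u ′) m t mRt)
             (1≤count (λ s → (rel m s ≟ᶠ c) ×-dec (rel s t ≟ᶠ cell v ′)) m′
                      (mRm′ , trans (transpose t m′) (cong _′ tRm′)))
  ...     | s , uRs , sRx = s , ′-injective (trans (sym (rel-to-x s)) sRx) , uRs

  p-positive⇒ : ∀ u v c → 0 < p (cell u ′) (cell v) c → c ≡ rel u v ⊎ c ≡ rel u (mate v)
  p-positive⇒ u v c pos =
    let s , cell-s , uRs = p-positive⇒∃ u v c pos
    in map (λ s≡v → trans (sym uRs) (cong (rel u) s≡v)) (λ s≡m → trans (sym uRs) (cong (rel u) s≡m))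
           (same-cell v s cell-s)

  p-positive-mate : ∀ u v → 0 < p (cell u ′) (cell v) (rel u (mate v))
  p-positive-mate u v = subst (λ z → 0 < p (cell u ′) z (rel u (mate v))) (cell-mate v) (p-positive u (mate v))

  prodSize≡countᵇ : ∀ u v →
    prodSize (cell u ′) (cell v) ≡ countᵇ (λ c → does (0 ℕ.<? p (cell u ′) (cell v) c))
  prodSize≡countᵇ u v = count≡countᵇ (λ c → 0 ℕ.<? p (cell u ′) (cell v) c)

  prodSize-collapsed : ∀ u v → rel u v ≡ rel u (mate v) → prodSize (cell u ′) (cell v) ≡ 1
  prodSize-collapsed u v e = trans (prodSize≡countᵇ u v)
    (trans (countᵇ-support₁ _ (rel u v) supp) (cong toℕᵇ (dec-true (0 ℕ.<? _) (p-positive u v))))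
    where
    supp : ∀ c → does (0 ℕ.<? p (cell u ′) (cell v) c) ≡ true → c ≡ rel u v
    supp c pos = [ id , (λ c≡b → trans c≡b (sym e)) ] (p-positive⇒ u v c (does≡true⇒ (0 ℕ.<? _) pos))

  prodSize-split : ∀ u v → rel u v ≢ rel u (mate v) → prodSize (cell u ′) (cell v) ≡ 2
  prodSize-split u v ne = trans (prodSize≡countᵇ u v)
    (trans (countᵇ-support₂ _ (rel u v) (rel u (mate v)) ne supp)
      (cong₂ _+_ (cong toℕᵇ (dec-true (0 ℕ.<? _) (p-positive u v)))
                 (cong toℕᵇ (dec-true (0 ℕ.<? _) (p-positive-mate u v)))))
    where
    supp : ∀ c → does (0 ℕ.<? p (cell u ′) (cell v) c) ≡ true → c ≡ rel u v ⊎ c ≡ rel u (mate v)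
    supp c pos = p-positive⇒ u v c (does≡true⇒ (0 ℕ.<? _) pos)

  Split : Fin n → Fin n → Set
  Split u v = mate u ≢ u × mate v ≢ v × rel u v ≢ rel u (mate v)

  InR⇒Split : ∀ u v → InR S x (cell u) (cell v) → Split u v
  InR⇒Split u v (k₁ , k₂ , size) =
    valency≡2⇒moved u k₁ , valency≡2⇒moved v k₂ , λ e → 1≢2 (trans (sym (prodSize-collapsed u v e)) size)
    where
    1≢2 : 1 ≢ 2
    1≢2 ()

  Split⇒InR : ∀ u v → Split u v → InR S x (cell u) (cell v)
  Split⇒InR u v (mu , mv , ne) = valency-moved u mu , valency-moved v mv , prodSize-split u v ne

  p≡1⇒Split : ∀ u v j → mate u ≢ u → p (cell u) j (cell v) ≡ 1 → rel u v ≢ rel u (mate v)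
  p≡1⇒Split u v j mu p≡1 e = double≢1 (does (rel u v ≟ᶠ j))
    (trans (cong (λ c → toℕᵇ (does (rel u v ≟ᶠ j)) + toℕᵇ (does (c ≟ᶠ j)))
                 (trans e (sym (rel-mate-swap u v))))
      (trans (sym (countᵇ-cell-moved u (λ m → does (rel m v ≟ᶠ j)) mu)) (trans (column-count u v j) p≡1)))
    where
    double≢1 : ∀ b → toℕᵇ b + toℕᵇ b ≢ 1
    double≢1 true  ()
    double≢1 false ()

  Split⇒p≡1 : ∀ u v → mate u ≢ u → rel u v ≢ rel u (mate v) → p (cell u) (rel u v) (cell v) ≡ 1
  Split⇒p≡1 u v mu ne = trans (sym (column-count u v (rel u v)))
    (trans (countᵇ-cell-moved u (λ m → does (rel m v ≟ᶠ rel u v)) mu)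
      (cong₂ _+_ (cong toℕᵇ (≟-refl (rel u v)))
                 (cong toℕᵇ (dec-false (rel (mate u) v ≟ᶠ rel u v)
                                        (λ e → ne (sym (trans (sym (rel-mate-swap u v)) e)))))))

  InR⇒p≡1 : ∀ y z → InR S x y z → ∃[ j ] p y j z ≡ 1
  InR⇒p≡1 y z r =
    let u , cell-u = cell-surjective y
        v , cell-v = cell-surjective z
        mu , _ , ne = InR⇒Split u v (subst₂ (InR S x) (sym cell-u) (sym cell-v) r)
    in subst₂ (λ a b → ∃[ j ] p a j b ≡ 1) cell-u cell-v (rel u v , Split⇒p≡1 u v mu ne)

  p≡1⇒InR : ∀ y z j → valency S x y ≡ 2 → valency S x z ≡ 2 → p y j z ≡ 1 → InR S x y z
  p≡1⇒InR y z j k₁ k₂ p≡1 with cell-surjective y | cell-surjective z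
  ... | u , refl | v , refl = Split⇒InR u v (mu , valency≡2⇒moved v k₂ , p≡1⇒Split u v j mu p≡1)
    where
    mu = valency≡2⇒moved u k₁

  InR? : ∀ y z → Dec (InR S x y z)
  InR? y z = (valency S x y ℕ.≟ 2) ×-dec ((valency S x z ℕ.≟ 2) ×-dec (prodSize (y ′) z ℕ.≟ 2))

  open Reachability (InR S x) InR? public

  walk-source : ∀ {y z} → Walk y z → valency S x y ≡ 2
  walk-source (edge e)     = proj₁ e
  walk-source (step e _ _) = proj₁ e

  walk-target : ∀ {y z} → Walk y z → valency S x z ≡ 2
  walk-target (edge e)     = proj₁ (proj₂ e)
  walk-target (step _ _ r) = walk-target r

  -- The data of a bad pair, without the conditions a ≥ 1 and |R_{y'} R_z| = 1.
  record Chain (y z : Fin (suc d)) : Set where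
    field
      steps       : ℕ
      i j ℓ       : Fin (suc steps) → Fin (suc d)
      starts      : i Fin.zero ≡ y
      ends        : ℓ (Fin.fromℕ steps) ≡ z
      links       : ∀ b → valency S x (i b) ≡ 2 × valency S x (ℓ b) ≡ 2 × p (i b) (j b) (ℓ b) ≡ 1
      consecutive : ∀ (c : Fin steps) → ℓ (Fin.inject₁ c) ≡ i (Fin.suc c)

  edge-chain : ∀ {y z} → InR S x y z → Chain y z
  edge-chain {y} {z} e@(k₁ , k₂ , _) = record
    { steps = 0 ; i = λ _ → y ; j = λ _ → proj₁ (InR⇒p≡1 y z e) ; ℓ = λ _ → z
    ; starts = refl ; ends = refl ; links = λ _ → k₁ , k₂ , proj₂ (InR⇒p≡1 y z e) ; consecutive = λ () }

  cons-chain : ∀ {y w z} → InR S x y w → Chain w z → Chain y z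
  cons-chain {y} {w} e@(k₁ , k₂ , _) C = record
    { steps = suc steps ; i = i′ ; j = j′ ; ℓ = ℓ′
    ; starts = refl ; ends = ends ; links = links′ ; consecutive = consecutive′ }
    where
    open Chain C
    i′ j′ ℓ′ : Fin (suc (suc steps)) → Fin (suc d)
    i′ Fin.zero    = y
    i′ (Fin.suc b) = i b
    j′ Fin.zero    = proj₁ (InR⇒p≡1 y w e)
    j′ (Fin.suc b) = j b
    ℓ′ Fin.zero    = i Fin.zero
    ℓ′ (Fin.suc b) = ℓ b
    links′ : ∀ b → valency S x (i′ b) ≡ 2 × valency S x (ℓ′ b) ≡ 2 × p (i′ b) (j′ b) (ℓ′ b) ≡ 1
    links′ Fin.zero    = k₁ , subst (λ t → valency S x t ≡ 2) (sym starts) k₂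
                       , subst (λ t → p y (j′ Fin.zero) t ≡ 1) (sym starts) (proj₂ (InR⇒p≡1 y w e))
    links′ (Fin.suc b) = links b
    consecutive′ : ∀ (c : Fin (suc steps)) → ℓ′ (Fin.inject₁ c) ≡ i′ (Fin.suc c)
    consecutive′ Fin.zero    = refl
    consecutive′ (Fin.suc c) = consecutive c

  walk⇒chain : ∀ {y z} → Walk y z → Chain y z
  walk⇒chain (edge e)     = edge-chain e
  walk⇒chain (step e _ r) = cons-chain e (walk⇒chain r)

  chain⇒walk : ∀ a (i j ℓ : Fin (suc a) → Fin (suc d)) →
    (∀ b → valency S x (i b) ≡ 2 × valency S x (ℓ b) ≡ 2 × p (i b) (j b) (ℓ b) ≡ 1) →
    (∀ (c : Fin a) → ℓ (Fin.inject₁ c) ≡ i (Fin.suc c)) →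
    Walk (i Fin.zero) (ℓ (Fin.fromℕ a))
  chain⇒walk zero    i j ℓ links _ with links Fin.zero
  ... | k₁ , k₂ , p≡1 = edge (p≡1⇒InR (i Fin.zero) (ℓ Fin.zero) (j Fin.zero) k₁ k₂ p≡1)
  chain⇒walk (suc a) i j ℓ links consecutive with links Fin.zero
  ... | k₁ , k₂ , p≡1 =
        step (p≡1⇒InR (i Fin.zero) (ℓ Fin.zero) (j Fin.zero) k₁ k₂ p≡1) tt
          (subst (λ t → Walk t (ℓ (Fin.fromℕ (suc a)))) (sym (consecutive Fin.zero))
            (chain⇒walk a (i ∘ Fin.suc) (j ∘ Fin.suc) (ℓ ∘ Fin.suc) (links ∘ Fin.suc) (consecutive ∘ Fin.suc)))

  InU⇒Walk : ∀ {y z} → InU S x y z → Walk y z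
  InU⇒Walk (inj₁ r) = edge r
  InU⇒Walk (inj₂ (a , _ , i , j , ℓ , refl , refl , links , consecutive , _)) =
    chain⇒walk a i j ℓ links consecutive

  -- A longer walk either certifies (y, z) ∈ 𝓡 directly, or its 2×2 block is collapsed and
  -- the walk is the chain of a bad pair.
  Walk⇒InU : ∀ {y z} → Walk y z → InU S x y z
  Walk⇒InU (edge e) = inj₁ e
  Walk⇒InU {y} {z} w@(step e _ r) with cell-surjective y | cell-surjective z
  ... | u , refl | v , refl with rel u v ≟ᶠ rel u (mate v)
  ...   | no split =
          inj₁ (Split⇒InR u v (valency≡2⇒moved u (walk-source w) , valency≡2⇒moved v (walk-target w) , split))
  ...   | yes collapsed = inj₂ (steps , s≤s z≤n , i , j , ℓ , starts , ends , links , consecutive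
                                , prodSize-collapsed u v collapsed)
    where open Chain (walk⇒chain w)

  InU? : ∀ y z → Dec (InU S x y z)
  InU? y z = map′ Walk⇒InU InU⇒Walk (walk? y z)

  InU-trans : ∀ {y z w} → InU S x y z → InU S x z w → InU S x y w
  InU-trans p q = Walk⇒InU (InU⇒Walk p ++ InU⇒Walk q)

  InU⇒valency≡2 : ∀ {y z} → InU S x y z → valency S x y ≡ 2 × valency S x z ≡ 2
  InU⇒valency≡2 q = walk-source (InU⇒Walk q) , walk-target (InU⇒Walk q)

module MatrixSums {c ℓ} (F : Field c ℓ) (n : ℕ) where
  open Field F
  open Matrices F n
  open import Algebra.Properties.CommutativeMonoid.Sum +-commutativeMonoid using (sum; sum-permute)

  ≡⇒≈ : ∀ {a b} → a ≡ b → a ≈ b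
  ≡⇒≈ ≡.refl = refl

  χ : Bool → Carrier
  χ b = if b then 1# else 0#

  χ-cong : ∀ {a b} → a ≡ b → χ a ≈ χ b
  χ-cong e = ≡⇒≈ (≡.cong χ e)

  Σᶠ-cong : ∀ {m} {f g : Fin m → Carrier} → (∀ i → f i ≈ g i) → Σᶠ f ≈ Σᶠ g
  Σᶠ-cong {zero}  e = refl
  Σᶠ-cong {suc m} e = +-cong (e Fin.zero) (Σᶠ-cong (e ∘ Fin.suc))

  Σᶠ-zero : ∀ {m} {f : Fin m → Carrier} → (∀ i → f i ≈ 0#) → Σᶠ f ≈ 0#
  Σᶠ-zero {zero}  e = refl
  Σᶠ-zero {suc m} e = trans (+-cong (e Fin.zero) (Σᶠ-zero (e ∘ Fin.suc))) (+-identityʳ 0#)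

  Σᶠ-single : ∀ {m} {f : Fin m → Carrier} (a : Fin m) → (∀ i → i ≢ a → f i ≈ 0#) → Σᶠ f ≈ f a
  Σᶠ-single {suc m} Fin.zero    h = trans (+-congˡ (Σᶠ-zero (λ i → h (Fin.suc i) λ ()))) (+-identityʳ _)
  Σᶠ-single {suc m} (Fin.suc a) h =
    trans (+-cong (h Fin.zero λ ()) (Σᶠ-single a (λ i i≢a → h (Fin.suc i) (i≢a ∘ suc-injective)))) (+-identityˡ _)

  Σᶠ≡sum : ∀ {m} (f : Fin m → Carrier) → Σᶠ f ≡ sum f
  Σᶠ≡sum {zero}  f = ≡.refl
  Σᶠ≡sum {suc m} f = ≡.cong (f Fin.zero +_) (Σᶠ≡sum (f ∘ Fin.suc))

  Σᶠ-involution : ∀ {m} (σ : Fin m → Fin m) → (∀ i → σ (σ i) ≡ i) → ∀ f → Σᶠ f ≈ Σᶠ (f ∘ σ)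
  Σᶠ-involution σ σσ f = trans (≡⇒≈ (Σᶠ≡sum f))
    (trans (sum-permute f (permutation σ σ σσ σσ)) (≡⇒≈ (≡.sym (Σᶠ≡sum (f ∘ σ)))))

module TerwilligerBasis {c ℓ ℓ<} (F : Field c ℓ) {n d : ℕ} (S : AssociationScheme n d) (x : Fin n)
                        (qt : QuasiThin S x) {_≺_ : Rel (Fin n) ℓ<} (sto : IsStrictTotalOrder _≡_ _≺_) where
  open Field F
  open AssociationScheme S using (rel; _′; →diag; diag→)
  open Terwilliger F S x hiding (B; rank)
  open MatrixSums F n
  open Counting
  open QuasiThinScheme S x qt
  open IsStrictTotalOrder sto using (compare; irrefl; asym) renaming (_<?_ to _≺?_)
  open import Relation.Binary.Reasoning.Setoid setoid

  B : Fin (suc d) → Fin (suc d) → Mat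
  B = Terwilliger.B F S x sto

  rank : Fin (suc d) → Fin n → ℕ
  rank = Terwilliger.rank F S x sto

  E*-left : ∀ y (N : Mat) u v → (E* y *ᴹ N) u v ≈ χ (does (cell u ≟ᶠ y)) * N u v
  E*-left y N u v =
    trans (Σᶠ-single u off-diagonal) (≡⇒≈ (≡.cong (λ b → χ (b ∧ does (cell u ≟ᶠ y)) * N u v) (≟-refl u)))
    where
    off-diagonal : ∀ t → t ≢ u → E* y u t * N t v ≈ 0#
    off-diagonal t t≢u rewrite dec-false (u ≟ᶠ t) (t≢u ∘ ≡.sym) = zeroˡ _

  E*-right : ∀ z (N : Mat) u v → (N *ᴹ E* z) u v ≈ N u v * χ (does (cell v ≟ᶠ z))
  E*-right z N u v =
    trans (Σᶠ-single v off-diagonal) (≡⇒≈ (≡.cong (λ b → N u v * χ (b ∧ does (cell v ≟ᶠ z))) (≟-refl v)))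
    where
    off-diagonal : ∀ t → t ≢ v → N u t * E* z t v ≈ 0#
    off-diagonal t t≢v rewrite dec-false (t ≟ᶠ v) t≢v = zeroʳ _

  E*NE*-at : ∀ y z (N : Mat) u v →
    ((E* y *ᴹ N) *ᴹ E* z) u v ≈ (χ (does (cell u ≟ᶠ y)) * N u v) * χ (does (cell v ≟ᶠ z))
  E*NE*-at y z N u v = trans (E*-right z (E* y *ᴹ N) u v) (*-congʳ (E*-left y N u v))

  ΣB-at : ∀ (cf : Fin (suc d) → Fin (suc d) → Carrier) u v →
    Σᶠ (λ i → Σᶠ (λ j → cf i j * B i j u v))
      ≈ cf (cell u) (cell v) * χ (does (rank (cell u) u ℕ.≟ rank (cell v) v))
  ΣB-at cf u v = begin
    Σᶠ (λ i → Σᶠ (λ j → cf i j * B i j u v))  ≈⟨ Σᶠ-single (cell u) other-row ⟩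
    Σᶠ (λ j → cf (cell u) j * B (cell u) j u v) ≈⟨ Σᶠ-single (cell v) (other-column (cell u)) ⟩
    cf (cell u) (cell v) * B (cell u) (cell v) u v
      ≈⟨ *-congˡ (χ-cong (≡.cong₂ (λ a b → a ∧ b ∧ does (rank (cell u) u ℕ.≟ rank (cell v) v))
                                  (≟-refl (cell u)) (≟-refl (cell v)))) ⟩
    cf (cell u) (cell v) * χ (does (rank (cell u) u ℕ.≟ rank (cell v) v)) ∎
    where
    other-column : ∀ i j → j ≢ cell v → cf i j * B i j u v ≈ 0#
    other-column i j j≢ rewrite dec-false (cell v ≟ᶠ j) (j≢ ∘ ≡.sym) =
      trans (*-congˡ (χ-cong (∧-zeroʳ (does (cell u ≟ᶠ i))))) (zeroʳ _)
    other-row : ∀ i → i ≢ cell u → Σᶠ (λ j → cf i j * B i j u v) ≈ 0#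
    other-row i i≢ = Σᶠ-zero λ j → zero-entry j
      where
      zero-entry : ∀ j → cf i j * B i j u v ≈ 0#
      zero-entry j rewrite dec-false (cell u ≟ᶠ i) (i≢ ∘ ≡.sym) = zeroʳ _

  EJE-at : ∀ y z u v → EJE y z u v ≈ χ (does (cell u ≟ᶠ y)) * χ (does (cell v ≟ᶠ z))
  EJE-at y z u v = trans (E*NE*-at y z Jᴹ u v) (*-congʳ (*-identityʳ _))

  ΣEJE-at : ∀ (ef : Fin (suc d) → Fin (suc d) → Carrier) u v →
    Σᶠ (λ y → Σᶠ (λ z → ef y z * EJE y z u v)) ≈ ef (cell u) (cell v)
  ΣEJE-at ef u v = begin
    Σᶠ (λ y → Σᶠ (λ z → ef y z * EJE y z u v))     ≈⟨ Σᶠ-single (cell u) other-row ⟩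
    Σᶠ (λ z → ef (cell u) z * EJE (cell u) z u v)  ≈⟨ Σᶠ-single (cell v) (other-column (cell u)) ⟩
    ef (cell u) (cell v) * EJE (cell u) (cell v) u v ≈⟨ *-congˡ (EJE-at (cell u) (cell v) u v) ⟩
    ef (cell u) (cell v) * (χ (does (cell u ≟ᶠ cell u)) * χ (does (cell v ≟ᶠ cell v)))
      ≈⟨ *-congˡ (≡⇒≈ (≡.cong₂ (λ a b → χ a * χ b) (≟-refl (cell u)) (≟-refl (cell v)))) ⟩
    ef (cell u) (cell v) * (1# * 1#)                ≈⟨ *-congˡ (*-identityʳ 1#) ⟩
    ef (cell u) (cell v) * 1#                       ≈⟨ *-identityʳ _ ⟩
    ef (cell u) (cell v) ∎
    where
    other-column : ∀ y z → z ≢ cell v → ef y z * EJE y z u v ≈ 0#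
    other-column y z z≢ = trans (*-congˡ (trans (EJE-at y z u v)
      (trans (*-congˡ (χ-cong (dec-false (cell v ≟ᶠ z) (z≢ ∘ ≡.sym)))) (zeroʳ _)))) (zeroʳ _)
    other-row : ∀ y → y ≢ cell u → Σᶠ (λ z → ef y z * EJE y z u v) ≈ 0#
    other-row y y≢ = Σᶠ-zero λ z → trans (*-congˡ (trans (EJE-at y z u v)
      (trans (*-congʳ (χ-cong (dec-false (cell u ≟ᶠ y) (y≢ ∘ ≡.sym)))) (zeroˡ _)))) (zeroʳ (ef y z))

  combo-at : ∀ cf ef {u v y z} → cell u ≡ y → cell v ≡ z →
    combo B cf ef u v ≈ cf y z * χ (does (rank y u ℕ.≟ rank z v)) + ef y z
  combo-at cf ef {u} {v} ≡.refl ≡.refl = +-cong (ΣB-at cf u v) (ΣEJE-at ef u v)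

  min-with-mate : Fin n → Fin n
  min-with-mate b with mate b ≺? b
  ... | yes _ = mate b
  ... | no _  = b

  min-with-mate-spec : ∀ b → cell (min-with-mate b) ≡ cell b × ¬ (mate (min-with-mate b) ≺ min-with-mate b)
  min-with-mate-spec b with mate b ≺? b
  ... | yes mb≺b = cell-mate b , λ b≺mb → asym mb≺b (≡.subst (_≺ mate b) (mate-involutive b) b≺mb)
  ... | no ¬mb≺b = ≡.refl , ¬mb≺b

  -- rep y and mate (rep y) are the paper's u₁ ≺ u₂ in x R_y (equal when k_y = 1).
  rep : Fin (suc d) → Fin n
  rep y = min-with-mate (proj₁ (cell-surjective y))

  rep-cell : ∀ y → cell (rep y) ≡ y
  rep-cell y = ≡.trans (proj₁ (min-with-mate-spec (proj₁ (cell-surjective y)))) (proj₂ (cell-surjective y))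

  rep-minimal : ∀ y → ¬ (mate (rep y) ≺ rep y)
  rep-minimal y = proj₂ (min-with-mate-spec (proj₁ (cell-surjective y)))

  rank≡countᵇ : ∀ i w → rank i w ≡ countᵇ (λ t → does (cell t ≟ᶠ i) ∧ does (t ≺? w))
  rank≡countᵇ i w = count≡countᵇ (λ t → (rel x t ≟ᶠ i) ×-dec (t ≺? w))

  rank-fixed : ∀ w → mate w ≡ w → rank (cell w) w ≡ 0
  rank-fixed w fixed = ≡.trans (rank≡countᵇ (cell w) w)
    (≡.trans (countᵇ-cell-fixed w (λ t → does (t ≺? w)) fixed)
             (≡.cong toℕᵇ (dec-false (w ≺? w) (irrefl ≡.refl))))

  rank-moved : ∀ w → mate w ≢ w → rank (cell w) w ≡ toℕᵇ (does (mate w ≺? w))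
  rank-moved w moved = ≡.trans (rank≡countᵇ (cell w) w)
    (≡.trans (countᵇ-cell-moved w (λ t → does (t ≺? w)) moved)
             (≡.cong (λ b → toℕᵇ b ℕ.+ toℕᵇ (does (mate w ≺? w))) (dec-false (w ≺? w) (irrefl ≡.refl))))

  rank-rep : ∀ y → rank y (rep y) ≡ 0
  rank-rep y with mate (rep y) ≟ᶠ rep y
  ... | yes fixed = ≡.subst (λ z → rank z (rep y) ≡ 0) (rep-cell y) (rank-fixed (rep y) fixed)
  ... | no moved  = ≡.subst (λ z → rank z (rep y) ≡ 0) (rep-cell y)
      (≡.trans (rank-moved (rep y) moved) (≡.cong toℕᵇ (dec-false (mate (rep y) ≺? rep y) (rep-minimal y))))

  ≺-connex : ∀ {a b} → a ≢ b → ¬ (b ≺ a) → a ≺ b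
  ≺-connex {a} {b} a≢b ¬b≺a with compare a b
  ... | tri< a≺b _ _ = a≺b
  ... | tri≈ _ a≡b _ = ⊥-elim (a≢b a≡b)
  ... | tri> _ _ b≺a = ⊥-elim (¬b≺a b≺a)

  rank-mate-rep : ∀ y → mate (rep y) ≢ rep y → rank y (mate (rep y)) ≡ 1
  rank-mate-rep y moved = ≡.subst (λ z → rank z (mate (rep y)) ≡ 1) (≡.trans (cell-mate (rep y)) (rep-cell y))
      (≡.trans (rank-moved (mate (rep y)) mate-moved)
        (≡.cong toℕᵇ (≡.trans (≡.cong (λ t → does (t ≺? mate (rep y))) (mate-involutive (rep y)))
                               (dec-true (rep y ≺? mate (rep y)) (≺-connex (moved ∘ ≡.sym) (rep-minimal y))))))
    where
    mate-moved : mate (mate (rep y)) ≢ mate (rep y)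
    mate-moved e = moved (≡.sym (≡.trans (≡.sym (mate-involutive (rep y))) e))

  data Position (y : Fin (suc d)) (w : Fin n) : Set where
    first  : w ≡ rep y → rank y w ≡ 0 → Position y w
    second : w ≡ mate (rep y) → mate (rep y) ≢ rep y → rank y w ≡ 1 → Position y w

  position : ∀ {y w} → cell w ≡ y → Position y w
  position {y} {w} e with same-cell (rep y) w (≡.trans e (≡.sym (rep-cell y)))
  ... | inj₁ w≡r = first w≡r (≡.trans (≡.cong (rank y) w≡r) (rank-rep y))
  ... | inj₂ w≡m with mate (rep y) ≟ᶠ rep y
  ...   | yes fixed = first (≡.trans w≡m fixed) (≡.trans (≡.cong (rank y) (≡.trans w≡m fixed)) (rank-rep y))
  ...   | no moved  = second w≡m moved (≡.trans (≡.cong (rank y) w≡m) (rank-mate-rep y moved))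

  record Invariant (M : Mat) : Set ℓ where
    field
      mate-both  : ∀ u v → M (mate u) (mate v) ≈ M u v
      mate-right : ∀ u v → ¬ InU S x (cell u) (cell v) → M u (mate v) ≈ M u v
  open Invariant

  InU-refl : ∀ v → mate v ≢ v → InU S x (cell v) (cell v)
  InU-refl v moved = inj₁ (Split⇒InR v v (moved , moved , distinct))
    where
    distinct : rel v v ≢ rel v (mate v)
    distinct e = moved (≡.sym (diag→ v (mate v) (≡.trans (≡.sym e) (→diag v v ≡.refl))))

  ¬InU⇒≢ : ∀ u v → ¬ InU S x (cell u) (cell v) → mate v ≢ v → u ≢ v × u ≢ mate v
  ¬InU⇒≢ u v ¬U moved =
    (λ { ≡.refl → ¬U (InU-refl v moved) }) ,
    (λ { ≡.refl → ¬U (≡.subst (λ t → InU S x t (cell v)) (≡.sym (cell-mate v)) (InU-refl v moved)) })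

  invariant-A : ∀ b → Invariant (A b)
  invariant-A b .mate-both u v = χ-cong (≡.cong (λ r → does (r ≟ᶠ b)) (rel-mate-mate u v))
  invariant-A b .mate-right u v ¬U with rel u (mate v) ≟ᶠ rel u v
  ... | yes e = χ-cong (≡.cong (λ r → does (r ≟ᶠ b)) e)
  ... | no ne = ⊥-elim (¬U (inj₁ (Split⇒InR u v (mu , mv , ne ∘ ≡.sym))))
    where
    mu : mate u ≢ u
    mu e = ne (≡.trans (≡.cong (λ t → rel t (mate v)) (≡.sym e)) (rel-mate-mate u v))
    mv : mate v ≢ v
    mv e = ne (≡.cong (rel u) e)

  does-mate-≟ : ∀ u v → does (mate u ≟ᶠ mate v) ≡ does (u ≟ᶠ v)
  does-mate-≟ u v = does-⇔ (mk⇔ mate-injective (≡.cong mate)) (mate u ≟ᶠ mate v) (u ≟ᶠ v)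

  invariant-diagonal : ∀ (f : Fin (suc d) → Bool) → Invariant (λ u v → χ (does (u ≟ᶠ v) ∧ f (cell u)))
  invariant-diagonal f .mate-both u v = χ-cong (≡.cong₂ _∧_ (does-mate-≟ u v) (≡.cong f (cell-mate u)))
  invariant-diagonal f .mate-right u v ¬U with mate v ≟ᶠ v
  ... | yes fixed = χ-cong (≡.cong (λ t → does (u ≟ᶠ t) ∧ f (cell u)) fixed)
  ... | no moved  rewrite dec-false (u ≟ᶠ mate v) (proj₂ (¬InU⇒≢ u v ¬U moved))
                        | dec-false (u ≟ᶠ v) (proj₁ (¬InU⇒≢ u v ¬U moved)) = refl

  invariant-resp : ∀ {M N} → M ≈ᴹ N → Invariant M → Invariant N
  invariant-resp M≈N I .mate-both u v =
    trans (sym (M≈N (mate u) (mate v))) (trans (I .mate-both u v) (M≈N u v))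
  invariant-resp M≈N I .mate-right u v ¬U =
    trans (sym (M≈N u (mate v))) (trans (I .mate-right u v ¬U) (M≈N u v))

  invariant-+ᴹ : ∀ {M N} → Invariant M → Invariant N → Invariant (M +ᴹ N)
  invariant-+ᴹ IM IN .mate-both u v     = +-cong (IM .mate-both u v) (IN .mate-both u v)
  invariant-+ᴹ IM IN .mate-right u v ¬U = +-cong (IM .mate-right u v ¬U) (IN .mate-right u v ¬U)

  invariant-·ᴹ : ∀ a {M} → Invariant M → Invariant (a ·ᴹ M)
  invariant-·ᴹ a IM .mate-both u v     = *-congˡ (IM .mate-both u v)
  invariant-·ᴹ a IM .mate-right u v ¬U = *-congˡ (IM .mate-right u v ¬U)

  flip-outside : Fin (suc d) → Fin n → Fin n
  flip-outside y t with InU? y (cell t)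
  ... | yes _ = t
  ... | no _  = mate t

  flip-outside-involutive : ∀ y t → flip-outside y (flip-outside y t) ≡ t
  flip-outside-involutive y t with InU? y (cell t)
  ... | yes q with InU? y (cell t)
  ...   | yes _ = ≡.refl
  ...   | no ¬q = ⊥-elim (¬q q)
  flip-outside-involutive y t | no ¬q with InU? y (cell (mate t))
  ...   | yes q = ⊥-elim (¬q (≡.subst (InU S x y) (cell-mate t) q))
  ...   | no _  = mate-involutive t

  -- For mate-right, reindex by flip-outside (cell u): when (cell u, cell t) ∈ 𝓤,
  -- transitivity of 𝓤 gives (cell t, cell v) ∉ 𝓤.
  invariant-*ᴹ : ∀ {M N} → Invariant M → Invariant N → Invariant (M *ᴹ N)
  invariant-*ᴹ {M} {N} IM IN .mate-both u v =
    trans (Σᶠ-involution mate mate-involutive (λ t → M (mate u) t * N t (mate v)))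
          (Σᶠ-cong (λ t → *-cong (IM .mate-both u t) (IN .mate-both t v)))
  invariant-*ᴹ {M} {N} IM IN .mate-right u v ¬U =
    trans (Σᶠ-involution (flip-outside (cell u)) (flip-outside-involutive (cell u)) (λ t → M u t * N t (mate v)))
          (Σᶠ-cong term)
    where
    term : ∀ t → M u (flip-outside (cell u) t) * N (flip-outside (cell u) t) (mate v) ≈ M u t * N t v
    term t with InU? (cell u) (cell t)
    ... | yes q  = *-congˡ (IN .mate-right t v (λ q′ → ¬U (InU-trans q q′)))
    ... | no ¬q  = *-cong (IM .mate-right u t ¬q) (IN .mate-both t v)

  InT⇒Invariant : ∀ {M} → InT M → Invariant M
  InT⇒Invariant (gen (adj b))  = invariant-A b
  InT⇒Invariant (gen (dual z)) = invariant-diagonal (λ y → does (y ≟ᶠ z))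
  InT⇒Invariant one            = invariant-resp (λ u v → χ-cong (∧-identityʳ (does (u ≟ᶠ v))))
                                              (invariant-diagonal (λ _ → true))
  InT⇒Invariant zer            = record { mate-both = λ _ _ → refl ; mate-right = λ _ _ _ → refl }
  InT⇒Invariant (add p q)      = invariant-+ᴹ (InT⇒Invariant p) (InT⇒Invariant q)
  InT⇒Invariant (mul p q)      = invariant-*ᴹ (InT⇒Invariant p) (InT⇒Invariant q)
  InT⇒Invariant (scal a p)     = invariant-·ᴹ a (InT⇒Invariant p)
  InT⇒Invariant (resp e p)     = invariant-resp e (InT⇒Invariant p)

  χ-interpolate : ∀ a b t → (a - b) * χ t + b ≈ (if t then a else b)
  χ-interpolate a b true = begin
    (a - b) * 1# + b   ≈⟨ +-congʳ (*-identityʳ _) ⟩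
    (a - b) + b        ≈⟨ +-assoc a (- b) b ⟩
    a + (- b + b)      ≈⟨ +-congˡ (-‿inverseˡ b) ⟩
    a + 0#             ≈⟨ +-identityʳ a ⟩
    a                  ∎
  χ-interpolate a b false = trans (+-congʳ (zeroʳ _)) (+-identityˡ b)

  combo-at-ranks : ∀ cf ef {u v y z ρ σ} → cell u ≡ y → cell v ≡ z → rank y u ≡ ρ → rank z v ≡ σ →
    combo B cf ef u v ≈ cf y z * χ (does (ρ ℕ.≟ σ)) + ef y z
  combo-at-ranks cf ef cu cv ru rv =
    trans (combo-at cf ef cu cv) (+-congʳ (*-congˡ (χ-cong (≡.cong₂ (λ r s → does (r ℕ.≟ s)) ru rv))))

  span : ∀ M → InT M →
    ∃[ cf ] ∃[ ef ] ((∀ i j → ¬ InU S x i j → cf i j ≈ 0#) × M ≈ᴹ combo B cf ef)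
  span M M∈T = cf , ef , vanish , λ u v → sym (expand (position ≡.refl) (position ≡.refl))
    where
    I = InT⇒Invariant M∈T
    cf ef : Fin (suc d) → Fin (suc d) → Carrier
    cf y z = M (rep y) (rep z) - M (rep y) (mate (rep z))
    ef y z = M (rep y) (mate (rep z))
    vanish : ∀ i j → ¬ InU S x i j → cf i j ≈ 0#
    vanish i j ¬U = trans (+-congʳ (sym (I .mate-right (rep i) (rep j)
                            (≡.subst₂ (λ a b → ¬ InU S x a b) (≡.sym (rep-cell i)) (≡.sym (rep-cell j)) ¬U))))
                          (-‿inverseʳ _)
    at : ∀ {u v a b} → u ≡ a → v ≡ b → M a b ≈ M u v
    at u≡a v≡b = ≡⇒≈ (≡.cong₂ M (≡.sym u≡a) (≡.sym v≡b))
    expand : ∀ {u v} → Position (cell u) u → Position (cell v) v → combo B cf ef u v ≈ M u v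
    expand (first u≡r ru) (first v≡s rv) =
      trans (combo-at-ranks cf ef ≡.refl ≡.refl ru rv) (trans (χ-interpolate _ _ true) (at u≡r v≡s))
    expand (first u≡r ru) (second v≡s′ _ rv) =
      trans (combo-at-ranks cf ef ≡.refl ≡.refl ru rv) (trans (χ-interpolate _ _ false) (at u≡r v≡s′))
    expand {u} {v} (second u≡r′ _ ru) (first v≡s rv) =
      trans (combo-at-ranks cf ef ≡.refl ≡.refl ru rv) (trans (χ-interpolate _ _ false)
        (trans (sym (I .mate-both r (mate s))) (at u≡r′ (≡.trans v≡s (≡.sym (mate-involutive s))))))
      where
      r = rep (cell u)
      s = rep (cell v)
    expand {u} {v} (second u≡r′ _ ru) (second v≡s′ _ rv) =
      trans (combo-at-ranks cf ef ≡.refl ≡.refl ru rv) (trans (χ-interpolate _ _ true)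
        (trans (sym (I .mate-both (rep (cell u)) (rep (cell v)))) (at u≡r′ v≡s′)))

  combo-at-reps : ∀ cf ef y z → combo B cf ef (rep y) (rep z) ≈ cf y z * 1# + ef y z
  combo-at-reps cf ef y z = combo-at-ranks cf ef (rep-cell y) (rep-cell z) (rank-rep y) (rank-rep z)

  combo-at-rep-mate : ∀ cf ef y z → mate (rep z) ≢ rep z →
    combo B cf ef (rep y) (mate (rep z)) ≈ cf y z * 0# + ef y z
  combo-at-rep-mate cf ef y z moved =
    combo-at-ranks cf ef (rep-cell y) (≡.trans (cell-mate (rep z)) (rep-cell z)) (rank-rep y) (rank-mate-rep z moved)

  independent : ∀ cf ef → (∀ i j → ¬ InU S x i j → cf i j ≈ 0#) → combo B cf ef ≈ᴹ 0ᴹ →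
                (∀ i j → cf i j ≈ 0#) × (∀ y z → ef y z ≈ 0#)
  independent cf ef vanish combo≈0 = (λ y z → proj₁ (both y z)) , (λ y z → proj₂ (both y z))
    where
    both : ∀ y z → cf y z ≈ 0# × ef y z ≈ 0#
    both y z with InU? y z
    ... | yes q = c≈0 , e≈0
      where
      moved : mate (rep z) ≢ rep z
      moved = valency≡2⇒moved (rep z) (≡.trans (≡.cong (valency S x) (rep-cell z)) (proj₂ (InU⇒valency≡2 q)))
      e≈0 : ef y z ≈ 0#
      e≈0 = begin
        ef y z              ≈⟨ sym (+-identityˡ _) ⟩
        0# + ef y z         ≈⟨ +-congʳ (sym (zeroʳ _)) ⟩
        cf y z * 0# + ef y z ≈⟨ sym (combo-at-rep-mate cf ef y z moved) ⟩
        combo B cf ef (rep y) (mate (rep z)) ≈⟨ combo≈0 (rep y) (mate (rep z)) ⟩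
        0#                  ∎
      c≈0 : cf y z ≈ 0#
      c≈0 = begin
        cf y z               ≈⟨ sym (*-identityʳ _) ⟩
        cf y z * 1#          ≈⟨ sym (+-identityʳ _) ⟩
        cf y z * 1# + 0#     ≈⟨ +-congˡ (sym e≈0) ⟩
        cf y z * 1# + ef y z ≈⟨ sym (combo-at-reps cf ef y z) ⟩
        combo B cf ef (rep y) (rep z) ≈⟨ combo≈0 (rep y) (rep z) ⟩
        0#                   ∎
    ... | no ¬q = c≈0 , e≈0
      where
      c≈0 = vanish y z ¬q
      e≈0 : ef y z ≈ 0#
      e≈0 = begin
        ef y z               ≈⟨ sym (+-identityˡ _) ⟩
        0# + ef y z          ≈⟨ +-congʳ (sym (trans (*-congʳ c≈0) (zeroˡ _))) ⟩
        cf y z * 1# + ef y z ≈⟨ sym (combo-at-reps cf ef y z) ⟩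
        combo B cf ef (rep y) (rep z) ≈⟨ combo≈0 (rep y) (rep z) ⟩
        0#                   ∎

  Σᶠ-InT : ∀ {m} (f : Fin m → Mat) → (∀ i → InT (f i)) → InT (Σᴹ f)
  Σᶠ-InT {zero}  f f∈T = resp (λ _ _ → refl) zer
  Σᶠ-InT {suc m} f f∈T = resp (λ _ _ → refl) (add (f∈T Fin.zero) (Σᶠ-InT (f ∘ Fin.suc) (f∈T ∘ Fin.suc)))

  J∈T : InT Jᴹ
  J∈T = resp ΣA≈J (Σᶠ-InT A (gen ∘ adj))
    where
    ΣA≈J : Σᴹ A ≈ᴹ Jᴹ
    ΣA≈J u v = trans (Σᶠ-single (rel u v) (λ b b≢ → χ-cong (dec-false (rel u v ≟ᶠ b) (b≢ ∘ ≡.sym))))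
                     (χ-cong (≟-refl (rel u v)))

  EJE∈T : ∀ y z → InT (EJE y z)
  EJE∈T y z = mul (mul (gen (dual y)) J∈T) (gen (dual z))

  χ-∧³ : ∀ a b c → (χ a * χ c) * χ b ≈ χ (a ∧ b ∧ c)
  χ-∧³ true  true  c = trans (*-identityʳ _) (*-identityˡ _)
  χ-∧³ true  false c = zeroʳ _
  χ-∧³ false b     c = trans (*-congʳ (zeroˡ _)) (zeroˡ _)

  ∧-guarded-cong : ∀ {P Q : Set} (P? : Dec P) (Q? : Dec Q) {c c′ : Bool} →
    (P → Q → c ≡ c′) → does P? ∧ does Q? ∧ c ≡ does P? ∧ does Q? ∧ c′
  ∧-guarded-cong (yes p) (yes q) h = h p q
  ∧-guarded-cong (yes _) (no _)  _ = ≡.refl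
  ∧-guarded-cong (no _)  _       _ = ≡.refl

  ∧-absurd : ∀ {P Q : Set} (P? : Dec P) (Q? : Dec Q) → (P → Q → ⊥) → does P? ∧ does Q? ≡ false
  ∧-absurd (yes p) (yes q) h = ⊥-elim (h p q)
  ∧-absurd (yes _) (no _)  _ = ≡.refl
  ∧-absurd (no _)  _       _ = ≡.refl

  -- For (y, z) ∈ 𝓡 the block x R_y × x R_z carries two relations in a diagonal pattern.
  rel≡a⇔same-rank : ∀ {y z u v} → InR S x y z → Position y u → Position z v →
    does (rel u v ≟ᶠ rel (rep y) (rep z)) ≡ does (rank y u ℕ.≟ rank z v)
  rel≡a⇔same-rank {y} {z} {u} {v} r pu pv =
    does-⇔ (mk⇔ (forward pu pv) (backward pu pv)) (rel u v ≟ᶠ rel (rep y) (rep z)) (rank y u ℕ.≟ rank z v)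
    where
    split = InR⇒Split (rep y) (rep z) (≡.subst₂ (InR S x) (≡.sym (rep-cell y)) (≡.sym (rep-cell z)) r)
    a≢b : rel (rep y) (rep z) ≢ rel (rep y) (mate (rep z))
    a≢b = proj₂ (proj₂ split)
    forward : Position y u → Position z v → rel u v ≡ rel (rep y) (rep z) → rank y u ≡ rank z v
    forward (first _ ru)       (first _ rv)       _ = ≡.trans ru (≡.sym rv)
    forward (first u≡ _)       (second v≡ _ _)    e = ⊥-elim (a≢b (≡.trans (≡.sym e) (≡.cong₂ rel u≡ v≡)))
    forward (second u≡ _ _)    (first v≡ _)       e =
      ⊥-elim (a≢b (≡.trans (≡.sym e) (≡.trans (≡.cong₂ rel u≡ v≡) (rel-mate-swap (rep y) (rep z)))))
    forward (second _ _ ru)    (second _ _ rv)    _ = ≡.trans ru (≡.sym rv)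
    backward : Position y u → Position z v → rank y u ≡ rank z v → rel u v ≡ rel (rep y) (rep z)
    backward (first u≡ _)       (first v≡ _)       _ = ≡.cong₂ rel u≡ v≡
    backward (first _ ru)       (second _ _ rv)    e with () ← ≡.trans (≡.sym ru) (≡.trans e rv)
    backward (second _ _ ru)    (first _ rv)       e with () ← ≡.trans (≡.sym ru) (≡.trans e rv)
    backward (second u≡ _ _)    (second v≡ _ _)    _ = ≡.trans (≡.cong₂ rel u≡ v≡) (rel-mate-mate (rep y) (rep z))

  B∈T-edge : ∀ {y z} → InR S x y z → InT (B y z)
  B∈T-edge {y} {z} r = resp E*AE*≈B (mul (mul (gen (dual y)) (gen (adj a))) (gen (dual z)))
    where
    a = rel (rep y) (rep z)
    E*AE*≈B : ((E* y *ᴹ A a) *ᴹ E* z) ≈ᴹ B y z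
    E*AE*≈B u v = begin
      ((E* y *ᴹ A a) *ᴹ E* z) u v  ≈⟨ E*NE*-at y z (A a) u v ⟩
      (χ Du * χ Da) * χ Dv         ≈⟨ χ-∧³ Du Dv Da ⟩
      χ (Du ∧ Dv ∧ Da)
        ≈⟨ χ-cong (∧-guarded-cong (cell u ≟ᶠ y) (cell v ≟ᶠ z)
                    λ cu cv → rel≡a⇔same-rank r (position cu) (position cv)) ⟩
      B y z u v                    ∎
      where
      Du = does (cell u ≟ᶠ y)
      Dv = does (cell v ≟ᶠ z)
      Da = does (rel u v ≟ᶠ a)

  rank-position : ∀ {y u} → Position y u → rank y u ≡ 0 ⊎ rank y u ≡ 1
  rank-position (first _ r)    = inj₁ r
  rank-position (second _ _ r) = inj₂ r

  element-of-rank : ∀ w → valency S x w ≡ 2 → ∀ {ρ} → ρ ≡ 0 ⊎ ρ ≡ 1 →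
    Σ[ t₀ ∈ Fin n ] (cell t₀ ≡ w × rank w t₀ ≡ ρ × (∀ t → cell t ≡ w → rank w t ≡ ρ → t ≡ t₀))
  element-of-rank w _ (inj₁ ≡.refl) = rep w , rep-cell w , rank-rep w , unique
    where
    unique : ∀ t → cell t ≡ w → rank w t ≡ 0 → t ≡ rep w
    unique t ct rt with position ct
    ... | first t≡ _      = t≡
    ... | second _ _ rt′  with () ← ≡.trans (≡.sym rt′) rt
  element-of-rank w k≡2 (inj₂ ≡.refl) =
    mate (rep w) , ≡.trans (cell-mate (rep w)) (rep-cell w) , rank-mate-rep w moved , unique
    where
    moved : mate (rep w) ≢ rep w
    moved = valency≡2⇒moved (rep w) (≡.trans (≡.cong (valency S x) (rep-cell w)) k≡2)
    unique : ∀ t → cell t ≡ w → rank w t ≡ 1 → t ≡ mate (rep w)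
    unique t ct rt with position ct
    ... | first _ rt′     with () ← ≡.trans (≡.sym rt′) rt
    ... | second t≡ _ _   = t≡

  B-outside : ∀ {y z u} v → cell u ≢ y → B y z u v ≈ 0#
  B-outside {y} {u = u} v ¬cu rewrite dec-false (cell u ≟ᶠ y) ¬cu = refl

  B-inside : ∀ {y z u} v → cell u ≡ y →
    B y z u v ≈ χ (does (cell v ≟ᶠ z) ∧ does (rank y u ℕ.≟ rank z v))
  B-inside {y} {u = u} v cu rewrite dec-true (cell u ≟ᶠ y) cu = refl

  B∈T-step : ∀ {y w z} → InR S x y w → InT (B w z) → InT (B y z)
  B∈T-step {y} {w} {z} r Bwz∈T = resp (λ u v → BB≈B u v (cell u ≟ᶠ y)) (mul (B∈T-edge r) Bwz∈T)
    where
    BB≈B : ∀ u v → Dec (cell u ≡ y) → (B y w *ᴹ B w z) u v ≈ B y z u v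
    BB≈B u v (no ¬cu) =
      trans (Σᶠ-zero (λ t → trans (*-congʳ (B-outside t ¬cu)) (zeroˡ _))) (sym (B-outside v ¬cu))
    BB≈B u v (yes cu) = begin
      Σᶠ (λ t → B y w u t * B w z t v)  ≈⟨ Σᶠ-single t₀ off-t₀ ⟩
      B y w u t₀ * B w z t₀ v           ≈⟨ *-congʳ (trans (B-inside t₀ cu) (χ-cong (≡.cong₂ _∧_ t₀∈
                                             (dec-true (rank y u ℕ.≟ rank w t₀) (≡.sym rt₀))))) ⟩
      1# * B w z t₀ v                   ≈⟨ *-identityˡ _ ⟩
      B w z t₀ v                        ≈⟨ B-inside v ct₀ ⟩
      χ (does (cell v ≟ᶠ z) ∧ does (rank w t₀ ℕ.≟ rank z v))
        ≈⟨ χ-cong (≡.cong (λ k → does (cell v ≟ᶠ z) ∧ does (k ℕ.≟ rank z v)) rt₀) ⟩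
      χ (does (cell v ≟ᶠ z) ∧ does (rank y u ℕ.≟ rank z v)) ≈⟨ sym (B-inside v cu) ⟩
      B y z u v                         ∎
      where
      pick = element-of-rank w (proj₁ (proj₂ r)) (rank-position (position cu))
      t₀ = proj₁ pick
      ct₀ = proj₁ (proj₂ pick)
      rt₀ = proj₁ (proj₂ (proj₂ pick))
      t₀∈ = dec-true (cell t₀ ≟ᶠ w) ct₀
      off-t₀ : ∀ t → t ≢ t₀ → B y w u t * B w z t v ≈ 0#
      off-t₀ t t≢t₀ = trans (*-congʳ (trans (B-inside t cu)
        (χ-cong (∧-absurd (cell t ≟ᶠ w) (rank y u ℕ.≟ rank w t)
                          λ ct e → t≢t₀ (proj₂ (proj₂ (proj₂ pick)) t ct (≡.sym e))))))
        (zeroˡ _)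

  walk⇒B∈T : ∀ {y z} → Walk y z → InT (B y z)
  walk⇒B∈T (edge r)     = B∈T-edge r
  walk⇒B∈T (step r _ q) = B∈T-step r (walk⇒B∈T q)

corollary4p6 : ∀ {c ℓ ℓ<} (F : Field c ℓ) {n d : ℕ} (S : AssociationScheme n d) (x : Fin n)
    → QuasiThin S x
    → {_≺_ : Rel (Fin n) ℓ<} (sto : IsStrictTotalOrder _≡_ _≺_)
    → Terwilliger.IsBasis F S x (Terwilliger.B F S x sto)
corollary4p6 F S x qt sto =
  (λ i j q → walk⇒B∈T (InU⇒Walk q)) , EJE∈T , independent , span
  where
  open QuasiThinScheme S x qt using (InU⇒Walk)
  open TerwilligerBasis F S x qt sto
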